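{- Let $M$ be a finite $C$-algebra with $T,F,U$. Then $M$ is atomic if and only if $M$ is an ada (i.e. $M$ carries a unary operation $(\cdot)^{\downarrow}$ making it an ada).
   Context: A $C$-algebra is an algebra $\langle M,\vee,\wedge,\neg\rangle$ of type $(2,2,1)$ satisfying, for all $\alpha,\beta,\gamma$: $\neg\neg\alpha=\alpha$; $\neg(\alpha\wedge\beta)=\neg\alpha\vee\neg\beta$; $(\alpha\wedge\beta)\wedge\gamma=\alpha\wedge(\beta\wedge\gamma)$; $\alpha\wedge(\beta\vee\gamma)=(\alpha\wedge\beta)\vee(\alpha\wedge\gamma)$; $(\alpha\vee\beta)\wedge\gamma=(\alpha\wedge\gamma)\vee(\neg\alpha\wedge\beta\wedge\gamma)$; $\alpha\vee(\alpha\wedge\beta)=\alpha$; $(\alpha\wedge\beta)\vee(\beta\wedge\alpha)=(\beta\wedge\alpha)\vee(\alpha\wedge\beta)$. A $C$-algebra with $T,F,U$ has nullary operations $T,F,U$: $T$ is the two-sided identity for $\wedge$, $F$ the two-sided identity for $\vee$, $U$ the fixed point of $\neg$. An ada is a $C$-algebra with $T,F,U$ together with a unary operation $(\cdot)^{\downarrow}$ satisfying $F^{\downarrow}=F$, $U^{\downarrow}=F$, $T^{\downarrow}=T$, $\alpha\wedge\beta^{\downarrow}=\alpha\wedge(\alpha\wedge\beta)^{\downarrow}$, $\alpha^{\downarrow}\vee\neg(\alpha^{\downarrow})=T$, $\alpha=\alpha^{\downarrow}\vee\alpha$. Order: $a\leq b$ iff $a\vee b=b$. An atom is $a\neq F$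 such that every $b$ with $F\leq b\leq a$, $b\neq a$ equals $F$. For finitely many atoms $a_1,\dots,a_N$: if $a_{\sigma(1)}\vee\cdots\vee a_{\sigma(N)}=a_1\vee\cdots\vee a_N$ for every bijection $\sigma$ of $\{1,\dots,N\}$, then $\bigoplus_{i=1}^N a_i$ exists and equals this value. $M$ is atomic if every $a\neq F$ in $M$ equals $\bigoplus_{i=1}^N a_i$ for some finite set of atoms. -}

module Defs where

open import Data.Nat using (ℕ; zero; suc)
open import Data.Fin using (Fin)
import Data.Fin as Fin
open import Data.Fin.Permutation using (Permutation′; _⟨$⟩ʳ_)
open import Data.Product using (Σ; _×_; ∃)
open import Relation.Binary.PropositionalEquality using (_≡_; _≢_)
open import Function.Definitions using (Injective)
open import Function.Bundles using (_↔_)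

record CAlgebraTFU : Set₁ where
  infixr 6 _∨_
  infixr 7 _∧_
  field
    Carrier : Set
    _∨_ _∧_ : Carrier → Carrier → Carrier
    ¬_      : Carrier → Carrier
    T F U   : Carrier
    ¬¬-inv     : ∀ α → ¬ (¬ α) ≡ α
    deMorgan   : ∀ α β → ¬ (α ∧ β) ≡ (¬ α) ∨ (¬ β)
    ∧-assoc    : ∀ α β γ → (α ∧ β) ∧ γ ≡ α ∧ (β ∧ γ)
    ∧-distribˡ : ∀ α β γ → α ∧ (β ∨ γ) ≡ (α ∧ β) ∨ (α ∧ γ)
    ∨-∧-rdist  : ∀ α β γ → (α ∨ β) ∧ γ ≡ (α ∧ γ) ∨ ((¬ α) ∧ β ∧ γ)
    absorb     : ∀ α β → α ∨ (α ∧ β) ≡ α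
    ∧-comm-∨   : ∀ α β → (α ∧ β) ∨ (β ∧ α) ≡ (β ∧ α) ∨ (α ∧ β)
    T-identityˡ : ∀ α → T ∧ α ≡ α
    T-identityʳ : ∀ α → α ∧ T ≡ α
    F-identityˡ : ∀ α → F ∨ α ≡ α
    F-identityʳ : ∀ α → α ∨ F ≡ α
    ¬U          : ¬ U ≡ U

module _ (M : CAlgebraTFU) where
  open CAlgebraTFU M

  IsFinite : Set
  IsFinite = Σ ℕ (λ n → Carrier ↔ Fin n)

  IsAdaOp : (Carrier → Carrier) → Set
  IsAdaOp _↓ = (F ↓ ≡ F) × (U ↓ ≡ F) × (T ↓ ≡ T)
             × (∀ α β → α ∧ (β ↓) ≡ α ∧ ((α ∧ β) ↓))
             × (∀ α → (α ↓) ∨ (¬ (α ↓)) ≡ T)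
             × (∀ α → α ≡ (α ↓) ∨ α)

  IsAda : Set
  IsAda = Σ (Carrier → Carrier) IsAdaOp

  _≤_ : Carrier → Carrier → Set
  a ≤ b = a ∨ b ≡ b

  IsAtom : Carrier → Set
  IsAtom a = a ≢ F × (∀ b → F ≤ b → b ≤ a → b ≢ a → b ≡ F)

  ⋁ : ∀ {N} → (Fin N → Carrier) → Carrier
  ⋁ {zero}        a = F
  ⋁ {suc zero}    a = a Fin.zero
  ⋁ {suc (suc N)} a = a Fin.zero ∨ ⋁ (λ i → a (Fin.suc i))

  -- ⊕_{i} a_i exists and equals x: the join is independent of the order.
  IsOplus : ∀ {N} → (Fin N → Carrier) → Carrier → Set
  IsOplus {N} a x = (∀ (σ : Permutation′ N) → ⋁ (λ i → a (σ ⟨$⟩ʳ i)) ≡ ⋁ a)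
                  × (⋁ a ≡ x)

  IsAtomic : Set
  IsAtomic = ∀ a → a ≢ F →
    Σ ℕ (λ N → Σ (Fin N → Carrier) (λ as →
      Injective _≡_ _≡_ as × (∀ i → IsAtom (as i)) × IsOplus as a))

module Submission where

-- Call b Boolean when b ∧ F ≡ F, and say that x has a Boolean decomposition
-- when x ≡ b ∨ (x ∧ F) for a Boolean b (its "defined part").  The proof goes
-- through the intermediate property "every element has a Boolean
-- decomposition":
--   * ada ⇔ decompositions (no finiteness needed): x↓ is the defined part of
--     x; conversely, defined parts are unique, which yields the ada axioms.
--   * atomic ⇒ decompositions: every atom has one, and decompositions are
--     stable under joins of elements with a common upper bound.
--   * decompositions ⇒ atomic (M finite): the join J of all atoms below a is
--     order-independent; if J ≢ a, the defined part e of ¬ J gives e ∧ a ≢ F,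
--     and an atom below e ∧ a (finiteness: the strict order is well founded)
--     would be both below J and disjoint from J.

open import Defs using (CAlgebraTFU; IsFinite; IsAda; IsAtomic; IsAtom; ⋁)
import Defs

open import Algebra.Bundles using (CommutativeMonoid)
import Algebra.Properties.CommutativeMonoid.Sum as MonoidSum
open import Data.Empty using (⊥-elim)
open import Data.Fin using (Fin; zero; suc)
open import Data.Fin.Induction using (spo-wellFounded)
open import Data.Fin.Permutation using (Permutation′; _⟨$⟩ʳ_; transpose)
open import Data.Fin.Properties using (any?; inj⇒≟)
open import Data.List using (List; length; lookup; tabulate; filter)
open import Data.List.Membership.Propositional using (_∈_)
open import Data.List.Membership.Propositional.Properties
  using (∈-lookup; ∈-tabulate⁺; ∈-filter⁺; ∈-filter⁻)
open import Data.List.Relation.Unary.All as All using (All)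
open import Data.List.Relation.Unary.AllPairs using (_∷_)
open import Data.List.Relation.Unary.Any using (index)
open import Data.List.Relation.Unary.Any.Properties using (lookup-index)
open import Data.List.Relation.Unary.Unique.Propositional using (Unique)
import Data.List.Relation.Unary.Unique.Propositional.Properties as Unique
open import Data.Nat using (ℕ; zero; suc)
open import Data.Product using (Σ; ∃; _×_; _,_; proj₁; proj₂)
open import Data.Sum using (_⊎_; inj₁; inj₂)
open import Function using (_∘_)
open import Function.Bundles using (_⇔_; _↔_; Inverse; mk⇔)
open import Function.Definitions using (Injective)
open import Function.Properties.Inverse using (↔⇒↣)
open import Induction.WellFounded using (WellFounded; Acc; acc)
import Induction.WellFounded as WF
import Relation.Binary.Construct.On as On
open import Relation.Binary.Core using (Rel)
open import Relation.Binary.Definitions using (DecidableEquality)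
open import Relation.Binary.PropositionalEquality
open import Relation.Binary.Structures using (IsStrictPartialOrder)
open import Relation.Nullary using (Dec; yes; no; contradiction)
open import Relation.Nullary.Decidable using (_×-dec_; ¬?; decidable-stable)
open import Relation.Unary using (Decidable)

-- The laws dual to the axioms, obtained by conjugating each axiom with ¬.
module DualLaws (M : CAlgebraTFU) where
  open CAlgebraTFU M
  open ≡-Reasoning

  ¬-injective : ∀ {α β} → ¬ α ≡ ¬ β → α ≡ β
  ¬-injective {α} {β} p = trans (sym (¬¬-inv α)) (trans (cong ¬_ p) (¬¬-inv β))

  deMorgan∨ : ∀ α β → ¬ (α ∨ β) ≡ ¬ α ∧ ¬ β
  deMorgan∨ α β = begin
    ¬ (α ∨ β)             ≡⟨ cong ¬_ (cong₂ _∨_ (sym (¬¬-inv α)) (sym (¬¬-inv β))) ⟩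
    ¬ (¬ (¬ α) ∨ ¬ (¬ β)) ≡⟨ cong ¬_ (sym (deMorgan (¬ α) (¬ β))) ⟩
    ¬ (¬ (¬ α ∧ ¬ β))     ≡⟨ ¬¬-inv _ ⟩
    ¬ α ∧ ¬ β             ∎

  ∨-assoc : ∀ α β γ → (α ∨ β) ∨ γ ≡ α ∨ (β ∨ γ)
  ∨-assoc α β γ = ¬-injective (begin
    ¬ ((α ∨ β) ∨ γ)   ≡⟨ deMorgan∨ _ _ ⟩
    ¬ (α ∨ β) ∧ ¬ γ   ≡⟨ cong (_∧ ¬ γ) (deMorgan∨ _ _) ⟩
    (¬ α ∧ ¬ β) ∧ ¬ γ ≡⟨ ∧-assoc _ _ _ ⟩
    ¬ α ∧ (¬ β ∧ ¬ γ) ≡⟨ cong (¬ α ∧_) (sym (deMorgan∨ _ _)) ⟩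
    ¬ α ∧ ¬ (β ∨ γ)   ≡⟨ sym (deMorgan∨ _ _) ⟩
    ¬ (α ∨ (β ∨ γ))   ∎)

  ∨-distribˡ : ∀ α β γ → α ∨ (β ∧ γ) ≡ (α ∨ β) ∧ (α ∨ γ)
  ∨-distribˡ α β γ = ¬-injective (begin
    ¬ (α ∨ (β ∧ γ))           ≡⟨ deMorgan∨ _ _ ⟩
    ¬ α ∧ ¬ (β ∧ γ)           ≡⟨ cong (¬ α ∧_) (deMorgan _ _) ⟩
    ¬ α ∧ (¬ β ∨ ¬ γ)         ≡⟨ ∧-distribˡ _ _ _ ⟩
    (¬ α ∧ ¬ β) ∨ (¬ α ∧ ¬ γ) ≡⟨ cong₂ _∨_ (sym (deMorgan∨ _ _)) (sym (deMorgan∨ _ _)) ⟩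
    ¬ (α ∨ β) ∨ ¬ (α ∨ γ)     ≡⟨ sym (deMorgan _ _) ⟩
    ¬ ((α ∨ β) ∧ (α ∨ γ))     ∎)

  ∧-∨-rdist : ∀ α β γ → (α ∧ β) ∨ γ ≡ (α ∨ γ) ∧ ((¬ α) ∨ β ∨ γ)
  ∧-∨-rdist α β γ = ¬-injective (begin
    ¬ ((α ∧ β) ∨ γ)                     ≡⟨ deMorgan∨ _ _ ⟩
    ¬ (α ∧ β) ∧ ¬ γ                     ≡⟨ cong (_∧ ¬ γ) (deMorgan _ _) ⟩
    (¬ α ∨ ¬ β) ∧ ¬ γ                   ≡⟨ ∨-∧-rdist _ _ _ ⟩
    (¬ α ∧ ¬ γ) ∨ (¬ (¬ α) ∧ ¬ β ∧ ¬ γ) ≡⟨ cong₂ _∨_ (sym (deMorgan∨ _ _))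
                                            (cong (¬ (¬ α) ∧_) (sym (deMorgan∨ _ _))) ⟩
    ¬ (α ∨ γ) ∨ (¬ (¬ α) ∧ ¬ (β ∨ γ))   ≡⟨ cong (¬ (α ∨ γ) ∨_) (sym (deMorgan∨ _ _)) ⟩
    ¬ (α ∨ γ) ∨ ¬ ((¬ α) ∨ β ∨ γ)       ≡⟨ sym (deMorgan _ _) ⟩
    ¬ ((α ∨ γ) ∧ ((¬ α) ∨ β ∨ γ))       ∎)

  absorb∧ : ∀ α β → α ∧ (α ∨ β) ≡ α
  absorb∧ α β = ¬-injective (begin
    ¬ (α ∧ (α ∨ β))   ≡⟨ deMorgan _ _ ⟩
    ¬ α ∨ ¬ (α ∨ β)   ≡⟨ cong (¬ α ∨_) (deMorgan∨ _ _) ⟩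
    ¬ α ∨ (¬ α ∧ ¬ β) ≡⟨ absorb _ _ ⟩
    ¬ α               ∎)

  ∨-comm-∧ : ∀ α β → (α ∨ β) ∧ (β ∨ α) ≡ (β ∨ α) ∧ (α ∨ β)
  ∨-comm-∧ α β = ¬-injective (begin
    ¬ ((α ∨ β) ∧ (β ∨ α))     ≡⟨ deMorgan _ _ ⟩
    ¬ (α ∨ β) ∨ ¬ (β ∨ α)     ≡⟨ cong₂ _∨_ (deMorgan∨ _ _) (deMorgan∨ _ _) ⟩
    (¬ α ∧ ¬ β) ∨ (¬ β ∧ ¬ α) ≡⟨ ∧-comm-∨ _ _ ⟩
    (¬ β ∧ ¬ α) ∨ (¬ α ∧ ¬ β) ≡⟨ cong₂ _∨_ (sym (deMorgan∨ _ _)) (sym (deMorgan∨ _ _)) ⟩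
    ¬ (β ∨ α) ∨ ¬ (α ∨ β)     ≡⟨ sym (deMorgan _ _) ⟩
    ¬ ((β ∨ α) ∧ (α ∨ β))     ∎)

-- The dual C-algebra: swap ∨/∧ and T/F.  Instantiating a lemma at dual M
-- yields its dual statement about M for free.
dual : CAlgebraTFU → CAlgebraTFU
dual M = record
  { Carrier = Carrier ; _∨_ = _∧_ ; _∧_ = _∨_ ; ¬_ = ¬_ ; T = F ; F = T ; U = U
  ; ¬¬-inv = ¬¬-inv ; deMorgan = deMorgan∨ ; ∧-assoc = ∨-assoc
  ; ∧-distribˡ = ∨-distribˡ ; ∨-∧-rdist = ∧-∨-rdist ; absorb = absorb∧
  ; ∧-comm-∨ = ∨-comm-∧
  ; T-identityˡ = F-identityˡ ; T-identityʳ = F-identityʳ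
  ; F-identityˡ = T-identityˡ ; F-identityʳ = T-identityʳ ; ¬U = ¬U }
  where open CAlgebraTFU M
        open DualLaws M

module ConstantLaws (M : CAlgebraTFU) where
  open CAlgebraTFU M
  open DualLaws M
  open ≡-Reasoning

  ∧-idem : ∀ α → α ∧ α ≡ α
  ∧-idem α = trans (cong (α ∧_) (sym (F-identityʳ α))) (absorb∧ α F)

  ¬T≡F : ¬ T ≡ F
  ¬T≡F = begin
    ¬ T                   ≡⟨ sym (F-identityʳ _) ⟩
    ¬ T ∨ F               ≡⟨ cong₂ _∨_ (sym (¬¬-inv (¬ T))) (sym (¬¬-inv F)) ⟩
    ¬ (¬ (¬ T)) ∨ ¬ (¬ F) ≡⟨ sym (deMorgan _ _) ⟩
    ¬ (¬ (¬ T) ∧ ¬ F)     ≡⟨ cong (λ z → ¬ (z ∧ ¬ F)) (¬¬-inv T) ⟩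
    ¬ (T ∧ ¬ F)           ≡⟨ cong ¬_ (T-identityˡ _) ⟩
    ¬ (¬ F)               ≡⟨ ¬¬-inv F ⟩
    F                     ∎

  F-zeroˡ : ∀ α → F ∧ α ≡ F
  F-zeroˡ α = trans (sym (F-identityˡ _)) (absorb F α)

  ∨-¬-expand : ∀ α β → α ∨ β ≡ α ∨ (¬ α ∧ β)
  ∨-¬-expand α β = begin
    α ∨ β                     ≡⟨ sym (T-identityʳ _) ⟩
    (α ∨ β) ∧ T               ≡⟨ ∨-∧-rdist α β T ⟩
    (α ∧ T) ∨ (¬ α ∧ (β ∧ T)) ≡⟨ cong₂ (λ a b → a ∨ (¬ α ∧ b)) (T-identityʳ α) (T-identityʳ β) ⟩
    α ∨ (¬ α ∧ β)             ∎

  U-zeroˡ : ∀ β → U ∨ β ≡ U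
  U-zeroˡ β = trans (∨-¬-expand U β) (trans (cong (λ z → U ∨ (z ∧ β)) ¬U) (absorb U β))

module SelfDualConstantLaws (M : CAlgebraTFU) where
  open ConstantLaws M public
  open ConstantLaws (dual M) public using ()
    renaming (∧-idem to ∨-idem; ¬T≡F to ¬F≡T; ∨-¬-expand to ∧-¬-expand; U-zeroˡ to U-zeroˡ-∧)

module FLaws (M : CAlgebraTFU) where
  open CAlgebraTFU M
  open DualLaws M
  open SelfDualConstantLaws M
  open ≡-Reasoning

  ∧-idemˡ : ∀ a x → a ∧ (a ∧ x) ≡ a ∧ x
  ∧-idemˡ a x = trans (sym (∧-assoc a a x)) (cong (_∧ x) (∧-idem a))

  ∧F≡∧¬ : ∀ α → α ∧ F ≡ α ∧ ¬ α
  ∧F≡∧¬ α = trans (∧-¬-expand α F) (cong (α ∧_) (F-identityʳ _))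

  ¬∧self : ∀ α → ¬ α ∧ α ≡ ¬ α ∧ F
  ¬∧self α = sym (trans (∧F≡∧¬ (¬ α)) (cong (¬ α ∧_) (¬¬-inv α)))

  private
    excluded-middle-∧ : ∀ α → (α ∨ ¬ α) ∧ α ≡ α
    excluded-middle-∧ α = begin
      (α ∨ ¬ α) ∧ α               ≡⟨ ∨-∧-rdist α (¬ α) α ⟩
      (α ∧ α) ∨ (¬ α ∧ (¬ α ∧ α)) ≡⟨ cong₂ _∨_ (∧-idem α) (∧-idemˡ (¬ α) α) ⟩
      α ∨ (¬ α ∧ α)               ≡⟨ sym (∨-¬-expand α α) ⟩
      α ∨ α                       ≡⟨ ∨-idem α ⟩
      α                           ∎

    ∧F-split : ∀ α → α ∧ F ≡ (α ∧ F) ∨ (¬ α ∧ F)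
    ∧F-split α = begin
      α ∧ F                                   ≡⟨ cong (_∧ F) (sym (excluded-middle-∧ α)) ⟩
      ((α ∨ ¬ α) ∧ α) ∧ F                     ≡⟨ ∧-assoc _ _ _ ⟩
      (α ∨ ¬ α) ∧ (α ∧ F)                     ≡⟨ ∨-∧-rdist _ _ _ ⟩
      (α ∧ (α ∧ F)) ∨ (¬ α ∧ (¬ α ∧ (α ∧ F))) ≡⟨ cong₂ _∨_ (∧-idemˡ α F) (∧-idemˡ (¬ α) (α ∧ F)) ⟩
      (α ∧ F) ∨ (¬ α ∧ (α ∧ F))               ≡⟨ cong ((α ∧ F) ∨_) (sym (∧-assoc _ _ _)) ⟩
      (α ∧ F) ∨ ((¬ α ∧ α) ∧ F)               ≡⟨ cong (λ z → (α ∧ F) ∨ (z ∧ F)) (¬∧self α) ⟩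
      (α ∧ F) ∨ ((¬ α ∧ F) ∧ F)               ≡⟨ cong ((α ∧ F) ∨_) (trans (∧-assoc _ _ _)
                                                                   (cong (¬ α ∧_) (∧-idem F))) ⟩
      (α ∧ F) ∨ (¬ α ∧ F)                     ∎

  ∧F-¬ : ∀ α → α ∧ F ≡ ¬ α ∧ F
  ∧F-¬ α = begin
    α ∧ F                     ≡⟨ ∧F-split α ⟩
    (α ∧ F) ∨ (¬ α ∧ F)       ≡⟨ cong₂ _∨_ (∧F≡∧¬ α) (sym (¬∧self α)) ⟩
    (α ∧ ¬ α) ∨ (¬ α ∧ α)     ≡⟨ ∧-comm-∨ α (¬ α) ⟩
    (¬ α ∧ α) ∨ (α ∧ ¬ α)     ≡⟨ cong₂ _∨_ (¬∧self α) (sym (∧F≡∧¬ α)) ⟩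
    (¬ α ∧ F) ∨ (α ∧ F)       ≡⟨ cong (λ z → (¬ α ∧ F) ∨ (z ∧ F)) (sym (¬¬-inv α)) ⟩
    (¬ α ∧ F) ∨ (¬ (¬ α) ∧ F) ≡⟨ sym (∧F-split (¬ α)) ⟩
    ¬ α ∧ F                   ∎

  private
    ∧-sandwich : ∀ α β → (α ∧ (β ∧ α)) ∨ (α ∧ β) ≡ α ∧ β
    ∧-sandwich α β = begin
      (α ∧ (β ∧ α)) ∨ (α ∧ β)       ≡⟨ cong ((α ∧ (β ∧ α)) ∨_) (sym (∧-idemˡ α β)) ⟩
      (α ∧ (β ∧ α)) ∨ (α ∧ (α ∧ β)) ≡⟨ sym (∧-distribˡ _ _ _) ⟩
      α ∧ ((β ∧ α) ∨ (α ∧ β))       ≡⟨ cong (α ∧_) (sym (∧-comm-∨ α β)) ⟩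
      α ∧ ((α ∧ β) ∨ (β ∧ α))       ≡⟨ ∧-distribˡ _ _ _ ⟩
      (α ∧ (α ∧ β)) ∨ (α ∧ (β ∧ α)) ≡⟨ cong₂ _∨_ (∧-idemˡ α β) (sym (∧-assoc _ _ _)) ⟩
      (α ∧ β) ∨ ((α ∧ β) ∧ α)       ≡⟨ absorb _ _ ⟩
      α ∧ β                         ∎

  -- Used through its dual (α ∨ β) ∨ (α ∧ F) ≡ α ∨ β: the undefined part of α is
  -- absorbed by any join starting with α.
  ∧-absorb-∨T : ∀ α β → (α ∧ β) ∧ (α ∨ T) ≡ α ∧ β
  ∧-absorb-∨T α β = begin
    (α ∧ β) ∧ (α ∨ T)       ≡⟨ ∧-assoc _ _ _ ⟩
    α ∧ (β ∧ (α ∨ T))       ≡⟨ cong (α ∧_) (∧-distribˡ _ _ _) ⟩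
    α ∧ ((β ∧ α) ∨ (β ∧ T)) ≡⟨ cong (λ z → α ∧ ((β ∧ α) ∨ z)) (T-identityʳ β) ⟩
    α ∧ ((β ∧ α) ∨ β)       ≡⟨ ∧-distribˡ _ _ _ ⟩
    (α ∧ (β ∧ α)) ∨ (α ∧ β) ≡⟨ ∧-sandwich α β ⟩
    α ∧ β                   ∎

  ∧-¬-to-F : ∀ c y → c ∧ (y ∧ ¬ c) ≡ c ∧ (y ∧ F)
  ∧-¬-to-F c y = begin
    c ∧ (y ∧ ¬ c)                 ≡⟨ ∧-¬-expand c _ ⟩
    c ∧ (¬ c ∨ (y ∧ ¬ c))         ≡⟨ cong (c ∧_) (∨-distribˡ _ _ _) ⟩
    c ∧ ((¬ c ∨ y) ∧ (¬ c ∨ ¬ c)) ≡⟨ cong (λ z → c ∧ ((¬ c ∨ y) ∧ z))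
                                        (trans (∨-idem _) (sym (F-identityʳ _))) ⟩
    c ∧ ((¬ c ∨ y) ∧ (¬ c ∨ F))   ≡⟨ cong (c ∧_) (sym (∨-distribˡ _ _ _)) ⟩
    c ∧ (¬ c ∨ (y ∧ F))           ≡⟨ sym (∧-¬-expand c _) ⟩
    c ∧ (y ∧ F)                   ∎

module TwistLaws (M : CAlgebraTFU) where
  open CAlgebraTFU M
  open DualLaws M
  open ConstantLaws M
  open FLaws M
  open FLaws (dual M) using () renaming (∧-absorb-∨T to ∨-absorb-∧F)
  open ≡-Reasoning

  ∨-twist : ∀ α β → α ∨ (β ∨ α) ≡ α ∨ β
  ∨-twist α β = begin
    α ∨ (β ∨ α)                     ≡⟨ ∨-¬-expand _ _ ⟩
    α ∨ (¬ α ∧ (β ∨ α))             ≡⟨ cong (α ∨_) (∧-distribˡ _ _ _) ⟩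
    α ∨ ((¬ α ∧ β) ∨ (¬ α ∧ α))     ≡⟨ sym (∨-assoc _ _ _) ⟩
    (α ∨ (¬ α ∧ β)) ∨ (¬ α ∧ α)     ≡⟨ cong₂ _∨_ (sym (∨-¬-expand α β))
                                          (trans (¬∧self α) (sym (∧F-¬ α))) ⟩
    (α ∨ β) ∨ (α ∧ F)               ≡⟨ ∨-absorb-∧F α β ⟩
    α ∨ β                           ∎

module Order (M : CAlgebraTFU) where
  open CAlgebraTFU M
  open DualLaws M
  open SelfDualConstantLaws M
  open FLaws M
  open TwistLaws M
  open ≡-Reasoning

  infix 4 _≤_
  _≤_ : Carrier → Carrier → Set
  _≤_ = Defs._≤_ M

  ≤-refl : ∀ x → x ≤ x
  ≤-refl = ∨-idem

  ≤-trans : ∀ {x y z} → x ≤ y → y ≤ z → x ≤ z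
  ≤-trans {x} {y} {z} x≤y y≤z = begin
    x ∨ z       ≡⟨ cong (x ∨_) (sym y≤z) ⟩
    x ∨ (y ∨ z) ≡⟨ sym (∨-assoc _ _ _) ⟩
    (x ∨ y) ∨ z ≡⟨ cong (_∨ z) x≤y ⟩
    y ∨ z       ≡⟨ y≤z ⟩
    z           ∎

  ≤⇒∧ : ∀ {y x} → y ≤ x → y ∧ x ≡ y
  ≤⇒∧ {y} {x} y≤x = trans (cong (y ∧_) (sym y≤x)) (absorb∧ y x)

  ∧F-≤ : ∀ t → t ∧ F ≤ t
  ∧F-≤ t = begin
    (t ∧ F) ∨ t               ≡⟨ ∧-∨-rdist t F t ⟩
    (t ∨ t) ∧ (¬ t ∨ (F ∨ t)) ≡⟨ cong₂ (λ a b → a ∧ (¬ t ∨ b)) (∨-idem t) (F-identityˡ t) ⟩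
    t ∧ (¬ t ∨ t)             ≡⟨ sym (∧-¬-expand t t) ⟩
    t ∧ t                     ≡⟨ ∧-idem t ⟩
    t                         ∎

  private
    ∧-≤-absorb : ∀ {y z x} → y ≤ x → z ≤ x → (y ∧ z) ∨ y ≡ y
    ∧-≤-absorb {y} {z} {x} y≤x z≤x = begin
      (y ∧ z) ∨ y             ≡⟨ cong₂ (λ a b → (a ∧ z) ∨ b) (sym (≤⇒∧ y≤x)) (sym (≤⇒∧ y≤x)) ⟩
      ((y ∧ x) ∧ z) ∨ (y ∧ x) ≡⟨ cong (_∨ (y ∧ x)) (∧-assoc _ _ _) ⟩
      (y ∧ (x ∧ z)) ∨ (y ∧ x) ≡⟨ sym (∧-distribˡ _ _ _) ⟩
      y ∧ ((x ∧ z) ∨ x)       ≡⟨ cong (y ∧_) x∧z≤x ⟩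
      y ∧ x                   ≡⟨ ≤⇒∧ y≤x ⟩
      y                       ∎
      where
      x∧z≤x : (x ∧ z) ∨ x ≡ x
      x∧z≤x = begin
        (x ∧ z) ∨ x       ≡⟨ cong ((x ∧ z) ∨_) (sym (∧-idem x)) ⟩
        (x ∧ z) ∨ (x ∧ x) ≡⟨ sym (∧-distribˡ _ _ _) ⟩
        x ∧ (z ∨ x)       ≡⟨ cong (x ∧_) z≤x ⟩
        x ∧ x             ≡⟨ ∧-idem x ⟩
        x                 ∎

    twist-∧ : ∀ {y z x} → y ≤ x → z ≤ x → (y ∨ z) ∧ (z ∨ y) ≡ y ∨ z
    twist-∧ {y} {z} y≤x z≤x = begin
      (y ∨ z) ∧ (z ∨ y)                     ≡⟨ ∨-∧-rdist _ _ _ ⟩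
      (y ∧ (z ∨ y)) ∨ (¬ y ∧ (z ∧ (z ∨ y))) ≡⟨ cong₂ (λ a b → a ∨ (¬ y ∧ b)) y∧[z∨y] (absorb∧ z y) ⟩
      y ∨ (¬ y ∧ z)                         ≡⟨ sym (∨-¬-expand y z) ⟩
      y ∨ z                                 ∎
      where
      y∧[z∨y] : y ∧ (z ∨ y) ≡ y
      y∧[z∨y] = trans (∧-distribˡ _ _ _)
                  (trans (cong ((y ∧ z) ∨_) (∧-idem y)) (∧-≤-absorb y≤x z≤x))

    twist-∨ : ∀ y z → (y ∨ z) ∨ (z ∨ y) ≡ y ∨ z
    twist-∨ y z = begin
      (y ∨ z) ∨ (z ∨ y) ≡⟨ ∨-assoc _ _ _ ⟩
      y ∨ (z ∨ (z ∨ y)) ≡⟨ cong (y ∨_) (trans (sym (∨-assoc _ _ _)) (cong (_∨ y) (∨-idem z))) ⟩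
      y ∨ (z ∨ y)       ≡⟨ ∨-twist y z ⟩
      y ∨ z             ∎

  ∨-comm-bounded : ∀ {y z x} → y ≤ x → z ≤ x → y ∨ z ≡ z ∨ y
  ∨-comm-bounded {y} {z} y≤x z≤x = begin
    y ∨ z                                     ≡⟨ sym (twist-∨ y z) ⟩
    (y ∨ z) ∨ (z ∨ y)                         ≡⟨ cong₂ _∨_ (sym (twist-∧ y≤x z≤x)) (sym (twist-∧ z≤x y≤x)) ⟩
    ((y ∨ z) ∧ (z ∨ y)) ∨ ((z ∨ y) ∧ (y ∨ z)) ≡⟨ ∧-comm-∨ _ _ ⟩
    ((z ∨ y) ∧ (y ∨ z)) ∨ ((y ∨ z) ∧ (z ∨ y)) ≡⟨ cong₂ _∨_ (twist-∧ z≤x y≤x) (twist-∧ y≤x z≤x) ⟩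
    (z ∨ y) ∨ (y ∨ z)                         ≡⟨ twist-∨ z y ⟩
    z ∨ y                                     ∎

  ≤-antisym : ∀ {x y} → x ≤ y → y ≤ x → x ≡ y
  ≤-antisym {x} {y} x≤y y≤x = trans (sym y≤x) (trans (∨-comm-bounded y≤x (≤-refl x)) x≤y)

module Booleans (M : CAlgebraTFU) where
  open CAlgebraTFU M
  open DualLaws M
  open SelfDualConstantLaws M
  open FLaws M
  open FLaws (dual M) using () renaming (∧-absorb-∨T to ∨-absorb-∧F)
  open TwistLaws (dual M) using () renaming (∨-twist to ∧-twist)
  open Order M
  open ≡-Reasoning

  Boolean : Carrier → Set
  Boolean b = b ∧ F ≡ F

  Undefined : Carrier → Set
  Undefined s = s ∧ F ≡ s

  F-Boolean : Boolean F
  F-Boolean = F-zeroˡ F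

  Boolean-∧ : ∀ {a b} → Boolean a → Boolean b → Boolean (a ∧ b)
  Boolean-∧ {a} {b} a-bool b-bool = trans (∧-assoc _ _ _) (trans (cong (a ∧_) b-bool) a-bool)

  Boolean-∨ : ∀ {a b} → Boolean a → Boolean b → Boolean (a ∨ b)
  Boolean-∨ {a} {b} a-bool b-bool = begin
    (a ∨ b) ∧ F             ≡⟨ ∨-∧-rdist _ _ _ ⟩
    (a ∧ F) ∨ (¬ a ∧ b ∧ F) ≡⟨ cong₂ (λ u v → u ∨ (¬ a ∧ v)) a-bool b-bool ⟩
    F ∨ (¬ a ∧ F)           ≡⟨ F-identityˡ _ ⟩
    ¬ a ∧ F                 ≡⟨ sym (∧F-¬ a) ⟩
    a ∧ F                   ≡⟨ a-bool ⟩
    F                       ∎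

  private
    ¬[∧F] : ∀ p → ¬ (p ∧ F) ≡ p ∨ ¬ p
    ¬[∧F] p = begin
      ¬ (p ∧ F)       ≡⟨ cong ¬_ (trans (∧F-¬ p) (sym (¬∧self p))) ⟩
      ¬ (¬ p ∧ p)     ≡⟨ deMorgan _ _ ⟩
      ¬ (¬ p) ∨ ¬ p   ≡⟨ cong (_∨ ¬ p) (¬¬-inv p) ⟩
      p ∨ ¬ p         ∎

  Boolean⇒excluded-middle : ∀ {p} → Boolean p → p ∨ ¬ p ≡ T
  Boolean⇒excluded-middle {p} p-bool = trans (sym (¬[∧F] p)) (trans (cong ¬_ p-bool) ¬F≡T)

  excluded-middle⇒Boolean : ∀ {p} → p ∨ ¬ p ≡ T → Boolean p
  excluded-middle⇒Boolean {p} em = ¬-injective (trans (¬[∧F] p) (trans em (sym ¬F≡T)))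

  Boolean-split : ∀ {p} q → Boolean p → q ≡ (p ∧ q) ∨ (¬ p ∧ q)
  Boolean-split {p} q p-bool = begin
    q                           ≡⟨ sym (T-identityˡ q) ⟩
    T ∧ q                       ≡⟨ cong (_∧ q) (sym (Boolean⇒excluded-middle p-bool)) ⟩
    (p ∨ ¬ p) ∧ q               ≡⟨ ∨-∧-rdist _ _ _ ⟩
    (p ∧ q) ∨ (¬ p ∧ (¬ p ∧ q)) ≡⟨ cong ((p ∧ q) ∨_) (∧-idemˡ _ _) ⟩
    (p ∧ q) ∨ (¬ p ∧ q)         ∎

  Boolean-∧-≤ : ∀ {p} q → Boolean p → p ∧ q ≤ q
  Boolean-∧-≤ {p} q p-bool = begin
    (p ∧ q) ∨ q                                     ≡⟨ ∨-¬-expand _ _ ⟩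
    (p ∧ q) ∨ (¬ (p ∧ q) ∧ q)                       ≡⟨ cong (λ z → (p ∧ q) ∨ (z ∧ q)) (deMorgan p q) ⟩
    (p ∧ q) ∨ ((¬ p ∨ ¬ q) ∧ q)                     ≡⟨ cong ((p ∧ q) ∨_) (∨-∧-rdist _ _ _) ⟩
    (p ∧ q) ∨ ((¬ p ∧ q) ∨ (¬ (¬ p) ∧ (¬ q ∧ q)))   ≡⟨ cong (λ z → (p ∧ q) ∨ ((¬ p ∧ q) ∨ z)) lost-part ⟩
    (p ∧ q) ∨ ((¬ p ∧ q) ∨ ((p ∧ q) ∧ F))           ≡⟨ sym (∨-assoc _ _ _) ⟩
    ((p ∧ q) ∨ (¬ p ∧ q)) ∨ ((p ∧ q) ∧ F)           ≡⟨ ∨-absorb-∧F _ _ ⟩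
    (p ∧ q) ∨ (¬ p ∧ q)                             ≡⟨ sym (Boolean-split q p-bool) ⟩
    q                                               ∎
    where
    lost-part : ¬ (¬ p) ∧ (¬ q ∧ q) ≡ (p ∧ q) ∧ F
    lost-part = trans (cong₂ _∧_ (¬¬-inv p) (trans (¬∧self q) (sym (∧F-¬ q)))) (sym (∧-assoc _ _ _))

  Boolean-∧-comm : ∀ {a b} → Boolean a → Boolean b → a ∧ b ≡ b ∧ a
  Boolean-∧-comm {a} {b} a-bool b-bool = begin
    a ∧ b             ≡⟨ sym (absorbed b-bool a-bool) ⟩
    (b ∧ a) ∨ (a ∧ b) ≡⟨ sym (∧-comm-∨ a b) ⟩
    (a ∧ b) ∨ (b ∧ a) ≡⟨ absorbed a-bool b-bool ⟩
    b ∧ a             ∎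
    where
    absorbed : ∀ {a b} → Boolean a → Boolean b → (a ∧ b) ∨ (b ∧ a) ≡ b ∧ a
    absorbed {a} {b} a-bool b-bool = begin
      (a ∧ b) ∨ (b ∧ a)             ≡⟨ cong (_∨ (b ∧ a)) (sym ab∧ba) ⟩
      ((a ∧ b) ∧ (b ∧ a)) ∨ (b ∧ a) ≡⟨ Boolean-∧-≤ (b ∧ a) (Boolean-∧ a-bool b-bool) ⟩
      b ∧ a                         ∎
      where
      ab∧ba : (a ∧ b) ∧ (b ∧ a) ≡ a ∧ b
      ab∧ba = trans (∧-assoc _ _ _) (trans (cong (a ∧_) (∧-idemˡ b a)) (∧-twist a b))

  ∧F-Undefined : ∀ x → Undefined (x ∧ F)
  ∧F-Undefined x = trans (∧-assoc _ _ _) (cong (x ∧_) (∧-idem F))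

  Undefined-∧ : ∀ z {s} → Undefined s → Undefined (z ∧ s)
  Undefined-∧ z s-undef = trans (∧-assoc _ _ _) (cong (z ∧_) s-undef)

  Undefined-∨ : ∀ {s₁ s₂} → Undefined s₁ → Undefined s₂ → Undefined (s₁ ∨ s₂)
  Undefined-∨ {s₁} u₁ u₂ =
    trans (∨-∧-rdist _ _ _) (trans (cong₂ (λ a b → a ∨ (¬ s₁ ∧ b)) u₁ u₂) (sym (∨-¬-expand _ _)))

  Undefined-zeroˡ : ∀ {s} z → Undefined s → s ∧ z ≡ s
  Undefined-zeroˡ {s} z s-undef =
    trans (cong (_∧ z) (sym s-undef)) (trans (∧-assoc _ _ _) (trans (cong (s ∧_) (F-zeroˡ z)) s-undef))

module Decompositions (M : CAlgebraTFU) where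
  open CAlgebraTFU M
  open DualLaws M
  open SelfDualConstantLaws M
  open FLaws M
  open Order M
  open Booleans M
  open ≡-Reasoning

  IsDefinedPart : Carrier → Carrier → Set
  IsDefinedPart b x = Boolean b × (x ≡ b ∨ (x ∧ F))

  Decomposable : Carrier → Set
  Decomposable x = Σ Carrier λ b → IsDefinedPart b x

  AllDecomposable : Set
  AllDecomposable = ∀ x → Decomposable x

  defined-part-≤ : ∀ {b x} → x ≡ b ∨ (x ∧ F) → b ≤ x
  defined-part-≤ {b} {x} x≡ = begin
    b ∨ x             ≡⟨ cong (b ∨_) x≡ ⟩
    b ∨ (b ∨ (x ∧ F)) ≡⟨ sym (∨-assoc _ _ _) ⟩
    (b ∨ b) ∨ (x ∧ F) ≡⟨ cong (_∨ (x ∧ F)) (∨-idem b) ⟩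
    b ∨ (x ∧ F)       ≡⟨ sym x≡ ⟩
    x                 ∎

  defined-part-of-join : ∀ {c s x} → Boolean c → Undefined s → x ≡ c ∨ s → IsDefinedPart c x
  defined-part-of-join {c} {s} {x} c-bool s-undef x≡ = c-bool , (begin
    x                 ≡⟨ x≡ ⟩
    c ∨ s             ≡⟨ ∨-¬-expand c s ⟩
    c ∨ (¬ c ∧ s)     ≡⟨ cong (c ∨_) (sym undefined-part) ⟩
    c ∨ ((c ∨ s) ∧ F) ≡⟨ cong (λ w → c ∨ (w ∧ F)) (sym x≡) ⟩
    c ∨ (x ∧ F)       ∎)
    where
    undefined-part : (c ∨ s) ∧ F ≡ ¬ c ∧ s
    undefined-part = trans (∨-∧-rdist c s F)
      (trans (cong₂ (λ a b → a ∨ (¬ c ∧ b)) c-bool s-undef) (F-identityˡ _))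

  defined-part-unique : ∀ {b b′ x} → IsDefinedPart b x → IsDefinedPart b′ x → b ≡ b′
  defined-part-unique {b} {b′} (b-bool , x≡b) (b′-bool , x≡b′) =
    trans (below x≡b′ b-bool x≡b) (trans (Boolean-∧-comm b-bool b′-bool) (sym (below x≡b b′-bool x≡b′)))
    where
    below : ∀ {b b′ x} → x ≡ b ∨ (x ∧ F) → Boolean b′ → x ≡ b′ ∨ (x ∧ F) → b′ ≡ b′ ∧ b
    below {b} {b′} {x} x≡b b′-bool x≡b′ = begin
      b′                        ≡⟨ sym b′∧x ⟩
      b′ ∧ x                    ≡⟨ cong (b′ ∧_) x≡b ⟩
      b′ ∧ (b ∨ (x ∧ F))        ≡⟨ ∧-distribˡ _ _ _ ⟩
      (b′ ∧ b) ∨ (b′ ∧ (x ∧ F)) ≡⟨ cong ((b′ ∧ b) ∨_) (trans (sym (∧-assoc _ _ _))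
                                                          (trans (cong (_∧ F) b′∧x) b′-bool)) ⟩
      (b′ ∧ b) ∨ F              ≡⟨ F-identityʳ _ ⟩
      b′ ∧ b                    ∎
      where
      b′∧x : b′ ∧ x ≡ b′
      b′∧x = ≤⇒∧ (defined-part-≤ x≡b′)

  F-decomposable : Decomposable F
  F-decomposable = F , F-Boolean , sym (trans (cong (F ∨_) F-Boolean) (F-identityˡ F))

  -- An atom t is either undefined (defined part F) or Boolean (defined part t).
  atom-decomposable : ∀ {t} → IsAtom M t → Dec (Undefined t) → Decomposable t
  atom-decomposable t-atom (yes t-undef) = F , F-Boolean , sym (trans (F-identityˡ _) t-undef)
  atom-decomposable {t} t-atom (no t-def) =
    t , proj₂ t-atom (t ∧ F) (F-identityˡ _) (∧F-≤ t) t-def , sym (absorb t F)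

  decomposable-∨ : ∀ {x y₁ y₂} → y₁ ≤ x → y₂ ≤ x →
                   Decomposable y₁ → Decomposable y₂ → Decomposable (y₁ ∨ y₂)
  decomposable-∨ {x} {y₁} {y₂} y₁≤x y₂≤x (c₁ , c₁-bool , y₁≡) (c₂ , c₂-bool , y₂≡) =
    c₁ ∨ c₂ , defined-part-of-join (Boolean-∨ c₁-bool c₂-bool)
                (Undefined-∨ (∧F-Undefined y₁) (∧F-Undefined y₂)) regroup
    where
    u₁ = y₁ ∧ F
    u₂ = y₂ ∧ F
    swap : u₁ ∨ c₂ ≡ c₂ ∨ u₁
    swap = ∨-comm-bounded (≤-trans (∧F-≤ y₁) y₁≤x) (≤-trans (defined-part-≤ y₂≡) y₂≤x)
    regroup : y₁ ∨ y₂ ≡ (c₁ ∨ c₂) ∨ (u₁ ∨ u₂)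
    regroup = begin
      y₁ ∨ y₂               ≡⟨ cong₂ _∨_ y₁≡ y₂≡ ⟩
      (c₁ ∨ u₁) ∨ (c₂ ∨ u₂) ≡⟨ ∨-assoc _ _ _ ⟩
      c₁ ∨ (u₁ ∨ (c₂ ∨ u₂)) ≡⟨ cong (c₁ ∨_) (sym (∨-assoc _ _ _)) ⟩
      c₁ ∨ ((u₁ ∨ c₂) ∨ u₂) ≡⟨ cong (λ w → c₁ ∨ (w ∨ u₂)) swap ⟩
      c₁ ∨ ((c₂ ∨ u₁) ∨ u₂) ≡⟨ cong (c₁ ∨_) (∨-assoc _ _ _) ⟩
      c₁ ∨ (c₂ ∨ (u₁ ∨ u₂)) ≡⟨ sym (∨-assoc _ _ _) ⟩
      (c₁ ∨ c₂) ∨ (u₁ ∨ u₂) ∎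

module ComplementParts (M : CAlgebraTFU) where
  open CAlgebraTFU M
  open DualLaws M
  open SelfDualConstantLaws M
  open FLaws M
  open FLaws (dual M) using () renaming (∧-absorb-∨T to ∨-absorb-∧F)
  open Order M
  open Booleans M
  open ≡-Reasoning

  join-with-complement-part : ∀ {J a e} → J ≤ a → ¬ J ≡ e ∨ (¬ J ∧ F) → J ∨ (e ∧ a) ≡ a
  join-with-complement-part {J} {a} {e} J≤a ¬J≡ = begin
    J ∨ (e ∧ a)                 ≡⟨ ∨-distribˡ _ _ _ ⟩
    (J ∨ e) ∧ (J ∨ a)           ≡⟨ cong₂ _∧_ (sym J∨¬J) J≤a ⟩
    (J ∨ ¬ J) ∧ a               ≡⟨ ∨-∧-rdist _ _ _ ⟩
    (J ∧ a) ∨ (¬ J ∧ (¬ J ∧ a)) ≡⟨ cong₂ _∨_ (≤⇒∧ J≤a) (∧-idemˡ _ _) ⟩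
    J ∨ (¬ J ∧ a)               ≡⟨ sym (∨-¬-expand J a) ⟩
    J ∨ a                       ≡⟨ J≤a ⟩
    a                           ∎
    where
    J∨¬J : J ∨ ¬ J ≡ J ∨ e
    J∨¬J = begin
      J ∨ ¬ J               ≡⟨ cong (J ∨_) ¬J≡ ⟩
      J ∨ (e ∨ (¬ J ∧ F))   ≡⟨ cong (λ w → J ∨ (e ∨ w)) (sym (∧F-¬ J)) ⟩
      J ∨ (e ∨ (J ∧ F))     ≡⟨ sym (∨-assoc _ _ _) ⟩
      (J ∨ e) ∨ (J ∧ F)     ≡⟨ ∨-absorb-∧F J e ⟩
      J ∨ e                 ∎

  below-J-and-complement-part : ∀ {J a e t} → Boolean e → e ≤ ¬ J → t ≤ e ∧ a → t ≤ J → t ≡ F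
  below-J-and-complement-part {J} {a} {e} {t} e-bool e≤¬J t≤e∧a t≤J = begin
    t                   ≡⟨ Boolean-split t e-bool ⟩
    (e ∧ t) ∨ (¬ e ∧ t) ≡⟨ cong₂ _∨_ (annihilated t≤J e∧J≡F) (annihilated t≤e∧a ¬e∧e∧a≡F) ⟩
    F ∨ F               ≡⟨ F-identityˡ F ⟩
    F                   ∎
    where
    annihilated : ∀ {x y z} → x ≤ y → z ∧ y ≡ F → z ∧ x ≡ F
    annihilated {x} {y} {z} x≤y z∧y≡F = begin
      z ∧ x             ≡⟨ sym (F-identityʳ _) ⟩
      (z ∧ x) ∨ F       ≡⟨ cong ((z ∧ x) ∨_) (sym z∧y≡F) ⟩
      (z ∧ x) ∨ (z ∧ y) ≡⟨ sym (∧-distribˡ _ _ _) ⟩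
      z ∧ (x ∨ y)       ≡⟨ cong (z ∧_) x≤y ⟩
      z ∧ y             ≡⟨ z∧y≡F ⟩
      F                 ∎
    e∧J≡F : e ∧ J ≡ F
    e∧J≡F = begin
      e ∧ J         ≡⟨ cong (_∧ J) (sym (≤⇒∧ e≤¬J)) ⟩
      (e ∧ ¬ J) ∧ J ≡⟨ ∧-assoc _ _ _ ⟩
      e ∧ (¬ J ∧ J) ≡⟨ cong (e ∧_) (¬∧self J) ⟩
      e ∧ (¬ J ∧ F) ≡⟨ sym (∧-assoc _ _ _) ⟩
      (e ∧ ¬ J) ∧ F ≡⟨ cong (_∧ F) (≤⇒∧ e≤¬J) ⟩
      e ∧ F         ≡⟨ e-bool ⟩
      F             ∎
    ¬e∧e∧a≡F : ¬ e ∧ (e ∧ a) ≡ F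
    ¬e∧e∧a≡F = begin
      ¬ e ∧ (e ∧ a) ≡⟨ sym (∧-assoc _ _ _) ⟩
      (¬ e ∧ e) ∧ a ≡⟨ cong (_∧ a) (trans (¬∧self e) (trans (sym (∧F-¬ e)) e-bool)) ⟩
      F ∧ a         ≡⟨ F-zeroˡ a ⟩
      F             ∎

module AdaDecompositions (M : CAlgebraTFU) where
  open CAlgebraTFU M
  open DualLaws M
  open SelfDualConstantLaws M
  open FLaws M
  open Order M
  open Booleans M
  open Decompositions M
  open ≡-Reasoning

  ada⇒decomposable : IsAda M → AllDecomposable
  ada⇒decomposable (_↓ , _ , _ , ax-T↓ , ax-restrict , ax-excluded-middle , ax-below) x =
    x ↓ , excluded-middle⇒Boolean (ax-excluded-middle x) , (begin
      x                             ≡⟨ ax-below x ⟩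
      b ∨ x                         ≡⟨ ∨-¬-expand _ _ ⟩
      b ∨ (¬ b ∧ x)                 ≡⟨ cong (λ z → b ∨ (¬ b ∧ z)) x≡x∧b ⟩
      b ∨ (¬ b ∧ (x ∧ b))           ≡⟨ cong (λ z → b ∨ (¬ b ∧ (x ∧ z))) (sym (¬¬-inv b)) ⟩
      b ∨ (¬ b ∧ (x ∧ ¬ (¬ b)))     ≡⟨ cong (b ∨_) (∧-¬-to-F (¬ b) x) ⟩
      b ∨ (¬ b ∧ (x ∧ F))           ≡⟨ sym (∨-¬-expand _ _) ⟩
      b ∨ (x ∧ F)                   ∎)
    where
    b = x ↓
    x≡x∧b : x ≡ x ∧ b
    x≡x∧b = begin
      x            ≡⟨ sym (T-identityʳ x) ⟩
      x ∧ T        ≡⟨ cong (x ∧_) (sym ax-T↓) ⟩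
      x ∧ (T ↓)    ≡⟨ ax-restrict x T ⟩
      x ∧ ((x ∧ T) ↓) ≡⟨ cong (λ z → x ∧ (z ↓)) (T-identityʳ x) ⟩
      x ∧ b        ∎

  module FromDecompositions (decompose : AllDecomposable) where

    _↓ : Carrier → Carrier
    x ↓ = proj₁ (decompose x)

    ↓-Boolean : ∀ x → Boolean (x ↓)
    ↓-Boolean x = proj₁ (proj₂ (decompose x))

    ↓-decomposes : ∀ x → x ≡ x ↓ ∨ (x ∧ F)
    ↓-decomposes x = proj₂ (proj₂ (decompose x))

    ↓-unique : ∀ {b x} → IsDefinedPart b x → x ↓ ≡ b
    ↓-unique = defined-part-unique (proj₂ (decompose _))

    F↓ : F ↓ ≡ F
    F↓ = ↓-unique (defined-part-of-join F-Boolean (∧-idem F) (sym (F-identityˡ F)))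

    T↓ : T ↓ ≡ T
    T↓ = ↓-unique (defined-part-of-join (T-identityˡ F) (∧-idem F) (sym (F-identityʳ T)))

    -- U ↓ is Boolean and below U, hence undefined, hence F.
    U↓ : U ↓ ≡ F
    U↓ = trans (sym b-undefined) (↓-Boolean U)
      where
      b = U ↓
      b≡b∧U : b ≡ b ∧ U
      b≡b∧U = sym (≤⇒∧ (defined-part-≤ (↓-decomposes U)))
      b-undefined : b ∧ F ≡ b
      b-undefined = trans (cong (_∧ F) b≡b∧U)
                      (trans (∧-assoc _ _ _) (trans (cong (b ∧_) (U-zeroˡ-∧ F)) (sym b≡b∧U)))

    ↓-≤ : ∀ α → α ≡ α ↓ ∨ α
    ↓-≤ α = sym (defined-part-≤ (↓-decomposes α))

    ∧-via-↓ : ∀ α z → α ∧ z ≡ (α ↓ ∧ z) ∨ (¬ (α ↓) ∧ (α ∧ F))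
    ∧-via-↓ α z = begin
      α ∧ z                                     ≡⟨ cong (_∧ z) (↓-decomposes α) ⟩
      (α ↓ ∨ (α ∧ F)) ∧ z                       ≡⟨ ∨-∧-rdist _ _ _ ⟩
      (α ↓ ∧ z) ∨ (¬ (α ↓) ∧ (α ∧ F) ∧ z)       ≡⟨ cong (λ w → (α ↓ ∧ z) ∨ (¬ (α ↓) ∧ w))
                                                     (Undefined-zeroˡ z (∧F-Undefined α)) ⟩
      (α ↓ ∧ z) ∨ (¬ (α ↓) ∧ (α ∧ F))           ∎

    ↓-∧ : ∀ α β → (α ∧ β) ↓ ≡ α ↓ ∧ β ↓
    ↓-∧ α β = ↓-unique (defined-part-of-join (Boolean-∧ (↓-Boolean α) (↓-Boolean β))
                          (Undefined-∨ (Undefined-∧ (α ↓) (∧F-Undefined β))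
                                       (Undefined-∧ (¬ (α ↓)) (∧F-Undefined α)))
                          regroup)
      where
      regroup : α ∧ β ≡ (α ↓ ∧ β ↓) ∨ ((α ↓ ∧ (β ∧ F)) ∨ (¬ (α ↓) ∧ (α ∧ F)))
      regroup = begin
        α ∧ β                                                  ≡⟨ ∧-via-↓ α β ⟩
        (α ↓ ∧ β) ∨ (¬ (α ↓) ∧ (α ∧ F))                        ≡⟨ cong (λ w → (α ↓ ∧ w) ∨ (¬ (α ↓) ∧ (α ∧ F)))
                                                                     (↓-decomposes β) ⟩
        (α ↓ ∧ (β ↓ ∨ (β ∧ F))) ∨ (¬ (α ↓) ∧ (α ∧ F))          ≡⟨ cong (_∨ (¬ (α ↓) ∧ (α ∧ F))) (∧-distribˡ _ _ _) ⟩
        ((α ↓ ∧ β ↓) ∨ (α ↓ ∧ (β ∧ F))) ∨ (¬ (α ↓) ∧ (α ∧ F))  ≡⟨ ∨-assoc _ _ _ ⟩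
        (α ↓ ∧ β ↓) ∨ ((α ↓ ∧ (β ∧ F)) ∨ (¬ (α ↓) ∧ (α ∧ F)))  ∎

    ↓-restrict : ∀ α β → α ∧ β ↓ ≡ α ∧ (α ∧ β) ↓
    ↓-restrict α β = begin
      α ∧ β ↓                                         ≡⟨ ∧-via-↓ α (β ↓) ⟩
      (α ↓ ∧ β ↓) ∨ (¬ (α ↓) ∧ (α ∧ F))               ≡⟨ cong (_∨ (¬ (α ↓) ∧ (α ∧ F))) (sym (∧-idemˡ _ _)) ⟩
      (α ↓ ∧ (α ↓ ∧ β ↓)) ∨ (¬ (α ↓) ∧ (α ∧ F))       ≡⟨ cong (λ w → (α ↓ ∧ w) ∨ (¬ (α ↓) ∧ (α ∧ F)))
                                                           (sym (↓-∧ α β)) ⟩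
      (α ↓ ∧ (α ∧ β) ↓) ∨ (¬ (α ↓) ∧ (α ∧ F))         ≡⟨ sym (∧-via-↓ α _) ⟩
      α ∧ (α ∧ β) ↓                                   ∎

    decomposable⇒ada : IsAda M
    decomposable⇒ada = _↓ , F↓ , U↓ , T↓ , ↓-restrict
                     , (λ α → Boolean⇒excluded-middle (↓-Boolean α)) , ↓-≤

  open FromDecompositions using (decomposable⇒ada) public

-- A family with an upper bound has an
-- order-independent join (elements below a fixed a form a commutative monoid
-- under ∨), and an order-independent join is an upper bound of the family.
module FiniteJoins (M : CAlgebraTFU) where
  open CAlgebraTFU M
  open DualLaws M
  open SelfDualConstantLaws M
  open Order M

  ∨-least : ∀ {x y a} → x ≤ a → y ≤ a → x ∨ y ≤ a
  ∨-least x≤a y≤a = trans (∨-assoc _ _ _) (trans (cong (_ ∨_) y≤a) x≤a)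

  ⋁-least : ∀ {a N} (g : Fin N → Carrier) → (∀ i → g i ≤ a) → ⋁ M g ≤ a
  ⋁-least {N = zero}        g g≤a = F-identityˡ _
  ⋁-least {N = suc zero}    g g≤a = g≤a zero
  ⋁-least {N = suc (suc N)} g g≤a = ∨-least (g≤a zero) (⋁-least (g ∘ suc) (g≤a ∘ suc))

  ⋁-head : ∀ {N} (g : Fin (suc N) → Carrier) → g zero ≤ ⋁ M g
  ⋁-head {zero}  g = ∨-idem _
  ⋁-head {suc N} g = trans (sym (∨-assoc _ _ _)) (cong (_∨ ⋁ M (g ∘ suc)) (∨-idem _))

  OrderIndependent : ∀ {N} → (Fin N → Carrier) → Set
  OrderIndependent {N} g = ∀ (σ : Permutation′ N) → ⋁ M (g ∘ (σ ⟨$⟩ʳ_)) ≡ ⋁ M g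

  -- Move i to the front by a transposition.
  ⋁-upper : ∀ {N} (g : Fin N → Carrier) → OrderIndependent g → ∀ i → g i ≤ ⋁ M g
  ⋁-upper {suc N} g indep i = subst (g i ≤_) (indep σ) (⋁-head (g ∘ (σ ⟨$⟩ʳ_)))
    where σ = transpose zero i

  module _ (a : Carrier) where
    Below : Set
    Below = Σ Carrier (_≤ a)

    belowMonoid : CommutativeMonoid _ _
    belowMonoid = record
      { Carrier = Below
      ; _≈_ = λ u v → proj₁ u ≡ proj₁ v
      ; _∙_ = λ (x , x≤a) (y , y≤a) → x ∨ y , ∨-least x≤a y≤a
      ; ε = F , F-identityˡ a
      ; isCommutativeMonoid = record
        { isMonoid = record
          { isSemigroup = record
            { isMagma = record
              { isEquivalence = record { refl = refl ; sym = sym ; trans = trans }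
              ; ∙-cong = cong₂ _∨_ }
            ; assoc = λ _ _ _ → ∨-assoc _ _ _ }
          ; identity = (λ _ → F-identityˡ _) , (λ _ → F-identityʳ _) }
        ; comm = λ (_ , x≤a) (_ , y≤a) → ∨-comm-bounded x≤a y≤a } }

    open MonoidSum belowMonoid using (sum; sum-permute)

    ⋁≡sum : ∀ {N} (g : Fin N → Below) → ⋁ M (proj₁ ∘ g) ≡ proj₁ (sum g)
    ⋁≡sum {zero}        g = refl
    ⋁≡sum {suc zero}    g = sym (F-identityʳ _)
    ⋁≡sum {suc (suc N)} g = cong (proj₁ (g zero) ∨_) (⋁≡sum (g ∘ suc))

    bounded⇒order-independent : ∀ {N} (g : Fin N → Carrier) → (∀ i → g i ≤ a) → OrderIndependent g
    bounded⇒order-independent g g≤a σ =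
      trans (⋁≡sum (below ∘ (σ ⟨$⟩ʳ_)))
        (trans (sym (sum-permute below σ)) (sym (⋁≡sum below)))
      where
      below : Fin _ → Below
      below i = g i , g≤a i

module Finite {A : Set} {n : ℕ} (iso : A ↔ Fin n) where
  open Inverse iso using (to; from; strictlyInverseˡ; strictlyInverseʳ)

  from-injective : Injective _≡_ _≡_ from
  from-injective {i} {j} eq = trans (sym (strictlyInverseˡ i)) (trans (cong to eq) (strictlyInverseˡ j))

  ∃? : {P : A → Set} → Decidable P → Dec (∃ P)
  ∃? {P} P? with any? (P? ∘ from)
  ... | yes (i , p) = yes (from i , p)
  ... | no ¬p       = no λ (x , px) → ¬p (to x , subst P (sym (strictlyInverseʳ x)) px)

  wellFounded : ∀ {ℓ} {_⊏_ : Rel A ℓ} → IsStrictPartialOrder _≡_ _⊏_ → WellFounded _⊏_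
  wellFounded {_⊏_ = _⊏_} spo =
    WF.Subrelation.wellFounded round-trip
      (On.wellFounded to (spo-wellFounded (On.isStrictPartialOrder from spo)))
    where
    round-trip : ∀ {x y} → x ⊏ y → from (to x) ⊏ from (to y)
    round-trip {x} {y} = subst₂ _⊏_ (sym (strictlyInverseʳ x)) (sym (strictlyInverseʳ y))

  private
    lookup-injective : {xs : List A} → Unique xs → Injective _≡_ _≡_ (lookup xs)
    lookup-injective (_  ∷ _)  {zero}  {zero}  _  = refl
    lookup-injective (x∉ ∷ _)  {zero}  {suc j} eq = contradiction eq (All.lookup x∉ (∈-lookup j))
    lookup-injective (x∉ ∷ _)  {suc i} {zero}  eq = contradiction (sym eq) (All.lookup x∉ (∈-lookup i))
    lookup-injective (_  ∷ xs) {suc i} {suc j} eq = cong suc (lookup-injective xs eq)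

  enumerate : {P : A → Set} → Decidable P →
              Σ ℕ λ N → Σ (Fin N → A) λ f →
                Injective _≡_ _≡_ f × (∀ i → P (f i)) × (∀ x → P x → ∃ λ i → f i ≡ x)
  enumerate {P} P? =
    length xs , lookup xs , lookup-injective xs-unique
    , (λ i → proj₂ (∈-filter⁻ P? {xs = tabulate from} (∈-lookup i)))
    , λ x px → let x∈xs = ∈-filter⁺ P? (listed x) px in index x∈xs , sym (lookup-index x∈xs)
    where
    xs : List A
    xs = filter P? (tabulate from)
    xs-unique : Unique xs
    xs-unique = Unique.filter⁺ P? (Unique.tabulate⁺ from-injective)
    listed : ∀ x → x ∈ tabulate from
    listed x = subst (_∈ tabulate from) (strictlyInverseʳ x) (∈-tabulate⁺ (to x))

module FiniteAtoms (M : CAlgebraTFU) (finite : IsFinite M) where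
  open CAlgebraTFU M
  open Order M
  open Finite (proj₂ finite)

  _≟_ : DecidableEquality Carrier
  _≟_ = inj⇒≟ (↔⇒↣ (proj₂ finite))

  _⊏_ : Rel Carrier _
  x ⊏ y = x ≤ y × x ≢ y

  ⊏-isStrictPartialOrder : IsStrictPartialOrder _≡_ _⊏_
  ⊏-isStrictPartialOrder = record
    { isEquivalence = isEquivalence
    ; irrefl        = λ { refl (_ , x≢x) → x≢x refl }
    ; trans         = λ { (x≤y , _) (y≤z , y≢z) → ≤-trans x≤y y≤z
                                                 , λ { refl → y≢z (≤-antisym y≤z x≤y) } }
    ; <-resp-≈      = (λ { refl x⊏y → x⊏y }) , (λ { refl x⊏y → x⊏y })
    }

  Smaller : Carrier → Set
  Smaller y = ∃ λ b → b ≢ F × b ⊏ y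

  atom-or-smaller : ∀ {y} → y ≢ F → IsAtom M y ⊎ Smaller y
  atom-or-smaller {y} y≢F with ∃? (λ b → ¬? (b ≟ F) ×-dec ((b ∨ y) ≟ y) ×-dec ¬? (b ≟ y))
  ... | yes smaller = inj₂ smaller
  ... | no ¬smaller = inj₁ (y≢F , λ b _ b≤y b≢y →
                        decidable-stable (b ≟ F) (λ b≢F → ¬smaller (b , b≢F , b≤y , b≢y)))

  IsAtom? : Decidable (IsAtom M)
  IsAtom? t with t ≟ F
  ... | yes t≡F = no λ t-atom → proj₁ t-atom t≡F
  ... | no t≢F with atom-or-smaller t≢F
  ...   | inj₁ t-atom                  = yes t-atom
  ...   | inj₂ (b , b≢F , b≤t , b≢t) = no λ t-atom → b≢F (proj₂ t-atom b (F-identityˡ b) b≤t b≢t)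

  atom-below : ∀ y → y ≢ F → ∃ λ t → IsAtom M t × t ≤ y
  atom-below y = descend (wellFounded ⊏-isStrictPartialOrder y)
    where
    descend : ∀ {y} → Acc _⊏_ y → y ≢ F → ∃ λ t → IsAtom M t × t ≤ y
    descend {y} (acc smaller) y≢F with atom-or-smaller y≢F
    ... | inj₁ y-atom               = y , y-atom , ≤-refl y
    ... | inj₂ (b , b≢F , b≤y , b≢y) with descend (smaller (b≤y , b≢y)) b≢F
    ...   | t , t-atom , t≤b = t , t-atom , ≤-trans t≤b b≤y

module AtomicDecompositions (M : CAlgebraTFU) (finite : IsFinite M) where
  open CAlgebraTFU M
  open Order M
  open Booleans M
  open Decompositions M
  open ComplementParts M
  open FiniteJoins M
  open FiniteAtoms M finite
  open Finite (proj₂ finite) using (enumerate)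

  join-of-atoms-decomposable : ∀ {x N} (g : Fin N → Carrier) → (∀ i → g i ≤ x) →
                               (∀ i → IsAtom M (g i)) → Decomposable (⋁ M g)
  join-of-atoms-decomposable {N = zero}        g g≤x atoms = F-decomposable
  join-of-atoms-decomposable {N = suc zero}    g g≤x atoms =
    atom-decomposable (atoms zero) ((g zero ∧ F) ≟ g zero)
  join-of-atoms-decomposable {N = suc (suc N)} g g≤x atoms =
    decomposable-∨ (g≤x zero) (⋁-least (g ∘ suc) (g≤x ∘ suc))
      (atom-decomposable (atoms zero) ((g zero ∧ F) ≟ g zero))
      (join-of-atoms-decomposable (g ∘ suc) (g≤x ∘ suc) (atoms ∘ suc))

  atomic⇒decomposable : IsAtomic M → AllDecomposable
  atomic⇒decomposable atomic x with x ≟ F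
  ... | yes x≡F = subst Decomposable (sym x≡F) F-decomposable
  ... | no x≢F with atomic x x≢F
  ...   | _ , g , _ , atoms , indep , ⋁g≡x =
    subst Decomposable ⋁g≡x
      (join-of-atoms-decomposable g (λ i → subst (g i ≤_) ⋁g≡x (⋁-upper g indep i)) atoms)

  -- A family of elements below a that contains every atom below a joins to a:
  -- otherwise the defined part e of ¬ J leaves e ∧ a ≢ F, and an atom below
  -- e ∧ a would lie below J as well.
  join-of-all-atoms : AllDecomposable → ∀ {a N} (g : Fin N → Carrier) → (∀ i → g i ≤ a) →
                      (∀ t → IsAtom M t → t ≤ a → ∃ λ i → g i ≡ t) → ⋁ M g ≡ a
  join-of-all-atoms decompose {a} g g≤a complete with ⋁ M g ≟ a
  ... | yes J≡a = J≡a
  ... | no J≢a with decompose (¬ ⋁ M g)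
  ...   | e , e-bool , ¬J≡ with (e ∧ a) ≟ F
  ...     | yes e∧a≡F = ⊥-elim (J≢a (begin
                ⋁ M g             ≡⟨ sym (F-identityʳ _) ⟩
                ⋁ M g ∨ F         ≡⟨ cong (⋁ M g ∨_) (sym e∧a≡F) ⟩
                ⋁ M g ∨ (e ∧ a)   ≡⟨ join-with-complement-part (⋁-least g g≤a) ¬J≡ ⟩
                a                 ∎))
    where open ≡-Reasoning
  ...     | no e∧a≢F with atom-below (e ∧ a) e∧a≢F
  ...       | t , t-atom , t≤e∧a with complete t t-atom (≤-trans t≤e∧a (Boolean-∧-≤ a e-bool))
  ...         | i , gi≡t = ⊥-elim (proj₁ t-atom
                  (below-J-and-complement-part e-bool (defined-part-≤ ¬J≡) t≤e∧a t≤J))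
    where
    t≤J : t ≤ ⋁ M g
    t≤J = subst (_≤ ⋁ M g) gi≡t (⋁-upper g (bounded⇒order-independent a g g≤a) i)

  decomposable⇒atomic : AllDecomposable → IsAtomic M
  decomposable⇒atomic decompose a _ with enumerate (λ t → IsAtom? t ×-dec ((t ∨ a) ≟ a))
  ... | N , g , g-injective , atoms-below , complete =
    N , g , g-injective , proj₁ ∘ atoms-below
    , bounded⇒order-independent a g (proj₂ ∘ atoms-below)
    , join-of-all-atoms decompose g (proj₂ ∘ atoms-below) (λ t t-atom t≤a → complete t (t-atom , t≤a))

theorem2p53 : (M : CAlgebraTFU) → IsFinite M → (IsAtomic M ⇔ IsAda M)
theorem2p53 M finite = mk⇔
  (decomposable⇒ada ∘ atomic⇒decomposable)
  (decomposable⇒atomic ∘ ada⇒decomposable)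
  where
  open AdaDecompositions M
  open AtomicDecompositions M finite
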